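{- Let $p$ be a prime. Then $L(p^2)\le (p-1)\,L(p)$.
   Context: For an integer $m\ge 2$, a cycle modulo $m$ of length $k\ge 1$ is a sequence $x_1,\dots,x_k$ of pairwise distinct residues modulo $m$ such that $x_i^2\equiv x_{i+1}\pmod m$ for $1\le i\le k-1$ and $x_k^2\equiv x_1\pmod m$. $L(m)$ denotes the maximum length of a cycle modulo $m$. -}

module Defs where

open import Data.Nat using (ℕ; suc; _*_; _<_; _≤_; NonZero)
open import Data.Nat.DivMod using (_%_)
open import Data.Fin using (Fin; toℕ) renaming (suc to fsuc)
open import Data.Fin.Patterns using (0F)
open import Data.Product using (Σ; _×_)
open import Function.Definitions using (Injective)
open import Relation.Binary.PropositionalEquality using (_≡_)

-- Residues modulo m are represented by their canonical representatives
-- 0 ≤ x < m.  For such representatives, x² ≡ y (mod m) iff (x * x) % m ≡ y.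

next : ∀ {k} → Fin (suc k) → Fin (suc k)
next {k} i = Data.Fin.fromℕ< (Data.Nat.DivMod.m%n<n (suc (toℕ i)) (suc k))
  where import Data.Fin ; import Data.Nat.DivMod

record Cycle (m : ℕ) .{{_ : NonZero m}} (len : ℕ) : Set where
  field
    len-1    : ℕ
    len≡     : len ≡ suc len-1
    x        : Fin (suc len-1) → ℕ
    x<m      : ∀ i → x i < m
    distinct : Injective _≡_ _≡_ x
    squares  : ∀ i → (x i * x i) % m ≡ x (next i)

-- L(m) = l means: l is the maximum length of a cycle modulo m.
IsL : (m : ℕ) .{{_ : NonZero m}} → ℕ → Set
IsL m l = Cycle m l × (∀ k → Cycle m k → k ≤ l)

module Submission where

-- Let x₀, …, x_{a−1} be a cycle modulo p²; it is the orbit s_i of x₀ under squaring modulo p²,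
-- of exact period a.  The residues s_i mod p obey the squaring recurrence modulo p, and their
-- first return time d to s₀ mod p is the length of a cycle modulo p, so d ≤ L(p).  The number
-- c = x₀^p mod p² lies in the class of x₀ modulo p (Fermat's little theorem) and is fixed by
-- d squarings, since z^p mod p² depends only on z mod p (power lifting) and s_d ≡ s₀ (mod p).
-- If a > (p − 1)d, then s₀, s_d, …, s_{(p−1)d} are p distinct numbers below p² in that class,
-- and c is not among them (else the orbit would repeat after d < a steps): p + 1 numbers below
-- p² in one class modulo p, which is impossible.  Hence a ≤ (p − 1)d ≤ (p − 1)·L(p).

open import Defs

open import Data.Nat
open import Data.Nat.Properties
open import Data.Nat.DivMod
open import Data.Nat.Induction using (<-rec)
open import Data.Nat.GeneralisedArithmetic using (fold; fold-+)
open import Data.Nat.Divisibility using (m∣m*n; _∣_; divides; ∣⇒≤; _∣0; ∣m∣n⇒∣m+n; ∣m⇒∣m*n)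
open import Data.Nat.Primality using (Prime; euclidsLemma; prime⇒nonZero; prime⇒nonTrivial)
open import Data.Nat.Combinatorics using (_C_; nC1≡n; nCn≡1; k>n⇒nCk≡0; nCk+nC[k+1]≡[n+1]C[k+1])
open import Data.Nat.Tactic.RingSolver using (solve-∀)
open import Data.Fin using (Fin; toℕ; fromℕ; fromℕ<; inject₁)
  renaming (zero to fzero; suc to fsuc; _<_ to _<ᶠ_)
open import Data.Fin.Patterns using (0F)
open import Data.Fin.Properties
  using (toℕ≤pred[n]; toℕ-inject₁; toℕ-fromℕ; toℕ<n; toℕ-fromℕ<; toℕ-injective; pigeonhole)
  renaming (<⇒≢ to <ᶠ⇒≢)
open import Data.Product using (∃; ∃₂; _×_; _,_; proj₁; proj₂)
open import Data.Sum using (inj₁; inj₂)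
open import Relation.Binary.Definitions using (DecidableEquality; tri<; tri≈; tri>)
open import Data.Empty using (⊥; ⊥-elim)
open import Relation.Nullary using (¬_; Dec; yes; no)
open import Relation.Nullary.Decidable using (_×-dec_)
open import Function.Definitions using (Injective)
open import Function using (_∘_)
open import Relation.Binary.PropositionalEquality
import Algebra.Properties.CommutativeSemiring.Binomial as Binomial
import Algebra.Properties.Monoid.Sum as MonoidSum
import Algebra.Properties.Semiring.Mult as SemiringMult
import Algebra.Properties.Semiring.Exp as SemiringExp

binomial-absorption : ∀ n k → suc k * (suc n C suc k) ≡ suc n * (n C k)
binomial-absorption zero    zero    = refl
binomial-absorption zero    (suc k)
  rewrite k>n⇒nCk≡0 {1} {2 + k} (s≤s (s≤s z≤n)) | k>n⇒nCk≡0 {0} {suc k} (s≤s z≤n)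
  = *-zeroʳ (2 + k)
binomial-absorption (suc n) zero    = trans (+-identityʳ _) (trans (nC1≡n (2 + n)) (sym (*-identityʳ _)))
binomial-absorption (suc n) (suc k) = begin
  (2 + k) * ((2 + n) C (2 + k))          ≡⟨ cong ((2 + k) *_) (sym (nCk+nC[k+1]≡[n+1]C[k+1] (suc n) (suc k))) ⟩
  (2 + k) * (A + B)                      ≡⟨ regroup (suc k) A B ⟩
  suc k * A + (2 + k) * B + A            ≡⟨ cong₂ (λ u v → u + v + A) (binomial-absorption n k) (binomial-absorption n (suc k)) ⟩
  suc n * (n C k) + suc n * (n C suc k) + A  ≡⟨ cong (_+ A) (sym (*-distribˡ-+ (suc n) (n C k) (n C suc k))) ⟩
  suc n * (n C k + n C suc k) + A        ≡⟨ cong (λ u → suc n * u + A) (nCk+nC[k+1]≡[n+1]C[k+1] n k) ⟩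
  suc n * A + A                          ≡⟨ +-comm (suc n * A) A ⟩
  (2 + n) * A                            ∎
  where
  open ≡-Reasoning
  A B : ℕ
  A = suc n C suc k
  B = suc n C (2 + k)
  regroup : ∀ j A B → suc j * (A + B) ≡ j * A + suc j * B + A
  regroup = solve-∀

-- A prime p divides C(p,k) for 0 < k < p: it divides k·C(p,k) = p·C(p-1,k-1) but not k.
prime∣binomial : ∀ {n} → Prime (suc n) → ∀ k → 0 < k → k < suc n → suc n ∣ suc n C k
prime∣binomial {n} pr (suc k) _ k<p
  with euclidsLemma (suc k) (suc n C suc k) pr
         (divides (n C k) (trans (binomial-absorption n k) (*-comm (suc n) (n C k))))
... | inj₁ p∣k   = ⊥-elim (<⇒≱ k<p (∣⇒≤ p∣k))
... | inj₂ p∣pCk = p∣pCk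

module ℕ-Binomial = Binomial +-*-commutativeSemiring
module ℕ-Sum      = MonoidSum +-0-monoid
open SemiringMult +-*-semiring using () renaming (_×_ to _×ₛ_)
open SemiringExp  +-*-semiring using () renaming (_^_ to _^ₛ_)

×ₛ≡* : ∀ n y → n ×ₛ y ≡ n * y
×ₛ≡* zero    y = refl
×ₛ≡* (suc n) y = cong (y +_) (×ₛ≡* n y)

^ₛ≡^ : ∀ x n → x ^ₛ n ≡ x ^ n
^ₛ≡^ x zero    = refl
^ₛ≡^ x (suc n) = cong (x *_) (^ₛ≡^ x n)

binomialTerm≡ : ∀ n x k → ℕ-Binomial.binomialTerm x 1 n k ≡ (n C toℕ k) * x ^ toℕ k
binomialTerm≡ n x k = begin
  (n C j) ×ₛ (x ^ₛ j * 1 ^ₛ (n ∸ j))  ≡⟨ ×ₛ≡* (n C j) _ ⟩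
  (n C j) * (x ^ₛ j * 1 ^ₛ (n ∸ j))  ≡⟨ cong₂ (λ u v → (n C j) * (u * v)) (^ₛ≡^ x j) (trans (^ₛ≡^ 1 (n ∸ j)) (^-zeroˡ (n ∸ j))) ⟩
  (n C j) * (x ^ j * 1)              ≡⟨ cong ((n C j) *_) (*-identityʳ (x ^ j)) ⟩
  (n C j) * x ^ j                    ∎
  where
  open ≡-Reasoning
  j : ℕ
  j = toℕ k

∣-sum : ∀ {d} m (g : Fin m → ℕ) → (∀ i → d ∣ g i) → d ∣ ℕ-Sum.sum g
∣-sum zero    g d∣g = _ ∣0
∣-sum (suc m) g d∣g = ∣m∣n⇒∣m+n (d∣g fzero) (∣-sum m (g ∘ fsuc) (d∣g ∘ fsuc))

-- Freshman's dream: (x + 1)^p ≡ x^p + 1 (mod p), as the middle binomial coefficients vanish mod p.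
freshman : ∀ {n} → Prime (suc n) → ∀ x → (x + 1) ^ suc n % suc n ≡ (x ^ suc n + 1) % suc n
freshman {n} pr x = begin
  (x + 1) ^ p % p                 ≡⟨ cong (_% p) expansion ⟩
  (x ^ p + 1 + w * p) % p         ≡⟨ [m+kn]%n≡m%n (x ^ p + 1) w p ⟩
  (x ^ p + 1) % p                 ∎
  where
  open ≡-Reasoning
  p : ℕ
  p = suc n
  t : Fin (suc (suc n)) → ℕ
  t = ℕ-Binomial.binomialTerm x 1 p
  middle : Fin n → ℕ
  middle i = t (fsuc (inject₁ i))
  middle-divisible : ∀ i → p ∣ middle i
  middle-divisible i rewrite binomialTerm≡ p x (fsuc (inject₁ i)) =
    ∣m⇒∣m*n _ (prime∣binomial pr (suc (toℕ (inject₁ i))) (s≤s z≤n)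
                (s≤s (subst (_< n) (sym (toℕ-inject₁ i)) (toℕ<n i))))
  w : ℕ
  w = ℕ-Sum.sum middle / p
  middle≡ : ℕ-Sum.sum middle ≡ w * p
  middle≡ = sym (m/n*n≡m (∣-sum n middle middle-divisible))
  first : t fzero ≡ 1
  first = trans (binomialTerm≡ p x fzero) (+-identityʳ 1)
  last : t (fsuc (fromℕ n)) ≡ x ^ p
  last = trans (binomialTerm≡ p x (fsuc (fromℕ n)))
    (trans (cong (λ j → (p C j) * x ^ j) (cong suc (toℕ-fromℕ n)))
      (trans (cong (_* x ^ p) (nCn≡1 p)) (*-identityˡ (x ^ p))))
  expansion : (x + 1) ^ p ≡ x ^ p + 1 + w * p
  expansion = begin
    (x + 1) ^ p                        ≡⟨ sym (^ₛ≡^ (x + 1) p) ⟩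
    (x + 1) ^ₛ p                       ≡⟨ ℕ-Binomial.theorem p x 1 ⟩
    t fzero + ℕ-Sum.sum (t ∘ fsuc)     ≡⟨ cong₂ _+_ first (ℕ-Sum.sum-init-last (t ∘ fsuc)) ⟩
    1 + (ℕ-Sum.sum middle + t (fsuc (fromℕ n)))  ≡⟨ cong₂ (λ u v → 1 + (u + v)) middle≡ last ⟩
    1 + (w * p + x ^ p)                ≡⟨ regroup 1 (w * p) (x ^ p) ⟩
    x ^ p + 1 + w * p                  ∎
    where
    regroup : ∀ a b c → a + (b + c) ≡ c + a + b
    regroup = solve-∀

-- Fermat's little theorem a^p ≡ a (mod p), by induction on a using the freshman's dream.
fermat : ∀ {n} → Prime (suc n) → ∀ a → a ^ suc n % suc n ≡ a % suc n
fermat pr zero    = refl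
fermat {n} pr (suc a) = begin
  suc a ^ p % p                ≡⟨ cong (λ u → u ^ p % p) (+-comm 1 a) ⟩
  (a + 1) ^ p % p              ≡⟨ freshman pr a ⟩
  (a ^ p + 1) % p              ≡⟨ %-distribˡ-+ (a ^ p) 1 p ⟩
  (a ^ p % p + 1 % p) % p      ≡⟨ cong (λ u → (u + 1 % p) % p) (fermat pr a) ⟩
  (a % p + 1 % p) % p          ≡⟨ sym (%-distribˡ-+ a 1 p) ⟩
  (a + 1) % p                  ≡⟨ cong (_% p) (+-comm a 1) ⟩
  suc a % p                    ∎
  where
  open ≡-Reasoning
  p : ℕ
  p = suc n

binomial-mod-square : ∀ r q m k →
  ∃ λ u → (r + q * m) ^ suc k ≡ r ^ suc k + suc k * q * m * r ^ k + u * (m * m)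
binomial-mod-square r q m zero = 0 , regroup r q m
  where
  regroup : ∀ r q m → (r + q * m) * 1 ≡ r * 1 + 1 * q * m * 1 + 0 * (m * m)
  regroup = solve-∀
binomial-mod-square r q m (suc k) with binomial-mod-square r q m k
... | u , expand = r * u + suc k * q * q * r ^ k + q * u * m , (begin
  (r + q * m) * (r + q * m) ^ suc k                          ≡⟨ cong ((r + q * m) *_) expand ⟩
  (r + q * m) * (r ^ suc k + suc k * q * m * r ^ k + u * (m * m))  ≡⟨ regroup r q m k (r ^ k) u ⟩
  r * r ^ suc k + (2 + k) * q * m * r ^ suc k + (r * u + suc k * q * q * r ^ k + q * u * m) * (m * m)  ∎)
  where
  open ≡-Reasoning
  regroup : ∀ r q m k R u → (r + q * m) * (r * R + suc k * q * m * R + u * (m * m))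
    ≡ r * (r * R) + (2 + k) * q * m * (r * R) + (r * u + suc k * q * q * R + q * u * m) * (m * m)
  regroup = solve-∀

instance
  square-nonZero : ∀ {m} .{{_ : NonZero m}} → NonZero (m ^ 2)
  square-nonZero {m} = m^n≢0 m 2

power-lifting : ∀ m .{{_ : NonZero m}} a → a ^ m % m ^ 2 ≡ (a % m) ^ m % m ^ 2
power-lifting m@(suc k) a with binomial-mod-square (a % m) (a / m) m k
... | u , expand = begin
  a ^ m % m ^ 2                                        ≡⟨ cong (λ z → z ^ m % m ^ 2) (m≡m%n+[m/n]*n a m) ⟩
  (a % m + a / m * m) ^ m % m ^ 2                      ≡⟨ cong (_% m ^ 2) expand ⟩
  ((a % m) ^ m + m * q * m * R + u * (m * m)) % m ^ 2  ≡⟨ cong (_% m ^ 2) (regroup ((a % m) ^ m) m q R u) ⟩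
  ((a % m) ^ m + (q * R + u) * m ^ 2) % m ^ 2          ≡⟨ [m+kn]%n≡m%n ((a % m) ^ m) (q * R + u) (m ^ 2) ⟩
  (a % m) ^ m % m ^ 2                                  ∎
  where
  open ≡-Reasoning
  q R : ℕ
  q = a / m
  R = (a % m) ^ k
  regroup : ∀ x m q r u → x + m * q * m * r + u * (m * m) ≡ x + (q * r + u) * (m * (m * 1))
  regroup = solve-∀

pow-mod : ∀ M .{{_ : NonZero M}} z k → (z % M) ^ k % M ≡ z ^ k % M
pow-mod M z zero    = refl
pow-mod M z (suc k) = begin
  (z % M * (z % M) ^ k) % M                ≡⟨ %-distribˡ-* (z % M) ((z % M) ^ k) M ⟩
  (z % M % M * ((z % M) ^ k % M)) % M      ≡⟨ cong₂ (λ u v → (u * v) % M) (m%n%n≡m%n z M) (pow-mod M z k) ⟩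
  (z % M * (z ^ k % M)) % M                ≡⟨ sym (%-distribˡ-* z (z ^ k) M) ⟩
  (z * z ^ k) % M                          ∎
  where open ≡-Reasoning

square-pow : ∀ z k → (z * z) ^ k ≡ z ^ k * z ^ k
square-pow z zero    = refl
square-pow z (suc k) = trans (cong (z * z *_) (square-pow z k)) (regroup z (z ^ k))
  where
  regroup : ∀ z A → z * z * (A * A) ≡ z * A * (z * A)
  regroup = solve-∀

sq : (m : ℕ) .{{_ : NonZero m}} → ℕ → ℕ
sq m z = (z * z) % m

pow-sq-commute : ∀ M .{{_ : NonZero M}} k z → sq M z ^ k % M ≡ sq M (z ^ k % M)
pow-sq-commute M k z = begin
  ((z * z) % M) ^ k % M       ≡⟨ pow-mod M (z * z) k ⟩
  (z * z) ^ k % M             ≡⟨ cong (_% M) (square-pow z k) ⟩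
  (z ^ k * z ^ k) % M         ≡⟨ %-distribˡ-* (z ^ k) (z ^ k) M ⟩
  sq M (z ^ k % M)            ∎
  where open ≡-Reasoning

-- Pigeonhole in a residue class: at most m numbers below m² share a residue ρ modulo m,
-- because such a number is determined by its quotient by m, which is below m.
residue-class-pigeonhole : ∀ m .{{_ : NonZero m}} ρ (v : Fin (suc m) → ℕ) →
  (∀ i → v i < m ^ 2) → (∀ i → v i % m ≡ ρ) → ¬ Injective _≡_ _≡_ v
residue-class-pigeonhole m ρ v v<m² v≡ρ injective = no-collision (pigeonhole (n<1+n m) quotient)
  where
  quotient-bound : ∀ i → v i / m < m
  quotient-bound i = m<n*o⇒m/o<n {n = m} (subst (v i <_) (cong (m *_) (*-identityʳ m)) (v<m² i))
  quotient : Fin (suc m) → Fin m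
  quotient i = fromℕ< (quotient-bound i)
  determined : ∀ i j → v i / m ≡ v j / m → v i ≡ v j
  determined i j same = begin
    v i                    ≡⟨ m≡m%n+[m/n]*n (v i) m ⟩
    v i % m + v i / m * m  ≡⟨ cong₂ (λ u w → u + w * m) (trans (v≡ρ i) (sym (v≡ρ j))) same ⟩
    v j % m + v j / m * m  ≡⟨ sym (m≡m%n+[m/n]*n (v j) m) ⟩
    v j                    ∎
    where open ≡-Reasoning
  no-collision : (∃₂ λ i j → i <ᶠ j × quotient i ≡ quotient j) → ⊥
  no-collision (i , j , i<j , same) = <ᶠ⇒≢ i<j (injective (determined i j
    (trans (sym (toℕ-fromℕ< (quotient-bound i))) (trans (cong toℕ same) (toℕ-fromℕ< (quotient-bound j))))))

record FirstReturn {A : Set} (u : ℕ → A) (d : ℕ) : Set where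
  field
    positive : 0 < d
    returns  : u d ≡ u 0
    minimal  : ∀ k → 0 < k → k < d → u k ≢ u 0

module Recurrence {A : Set} (g : A → A) (u : ℕ → A) (step : ∀ i → u (suc i) ≡ g (u i)) where

  shift : ∀ t {i j} → u i ≡ u j → u (t + i) ≡ u (t + j)
  shift zero    same = same
  shift (suc t) {i} {j} same = trans (step (t + i)) (trans (cong g (shift t same)) (sym (step (t + j))))

  periodic : ∀ {d} → u d ≡ u 0 → ∀ i K → u (i + K * d) ≡ u i
  periodic {d} return i zero    = cong u (+-identityʳ i)
  periodic {d} return i (suc K) = begin
    u (i + (d + K * d))   ≡⟨ cong u (regroup i d (K * d)) ⟩
    u (i + K * d + d)     ≡⟨ shift (i + K * d) return ⟩
    u (i + K * d + 0)     ≡⟨ cong u (+-identityʳ (i + K * d)) ⟩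
    u (i + K * d)         ≡⟨ periodic return i K ⟩
    u i                   ∎
    where
    open ≡-Reasoning
    regroup : ∀ i d x → i + (d + x) ≡ i + x + d
    regroup = solve-∀

  periodic-mod : ∀ {d} .{{_ : NonZero d}} → u d ≡ u 0 → ∀ k → u (k % d) ≡ u k
  periodic-mod {d} return k =
    sym (trans (cong u (m≡m%n+[m/n]*n k d)) (periodic return (k % d) (k / d)))

  repetition⇒return : ∀ {a} .{{_ : NonZero a}} → u a ≡ u 0 → ∀ d e → u (d + e) ≡ u e → u d ≡ u 0
  repetition⇒return {a} return d e repeat = begin
    u d                   ≡⟨ sym (periodic return d e) ⟩
    u (d + e * a)         ≡⟨ cong (λ x → u (d + x)) (sym te≡) ⟩
    u (d + (t + e))       ≡⟨ cong u (regroup d t e) ⟩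
    u (t + (d + e))       ≡⟨ shift t repeat ⟩
    u (t + e)             ≡⟨ cong u te≡ ⟩
    u (e * a)             ≡⟨ periodic return 0 e ⟩
    u 0                   ∎
    where
    open ≡-Reasoning
    t : ℕ
    t = e * a ∸ e
    te≡ : t + e ≡ e * a
    te≡ = m∸n+n≡m (m≤m*n e a)
    regroup : ∀ d t e → d + (t + e) ≡ t + (d + e)
    regroup = solve-∀

  -- Before the first return no value repeats: a repetition u i = u j with i < j < d,
  -- shifted by d − j, would give an earlier return at time d − j + i.
  no-early-repetition : ∀ {d} → FirstReturn u d → ∀ {i j} → i < j → j < d → u i ≢ u j
  no-early-repetition {d} first {i} {j} i<j j<d same = FirstReturn.minimal first (t + i)
    (≤-trans (m<n⇒0<n∸m j<d) (m≤m+n t i))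
    (subst (t + i <_) tj≡d (+-monoʳ-< t i<j))
    (trans (shift t same) (trans (cong u tj≡d) (FirstReturn.returns first)))
    where
    t : ℕ
    t = d ∸ j
    tj≡d : t + j ≡ d
    tj≡d = m∸n+n≡m (<⇒≤ j<d)

  first-return-injective : ∀ {d} → FirstReturn u d → ∀ {i j} → i < d → j < d → u i ≡ u j → i ≡ j
  first-return-injective first {i} {j} i<d j<d same with <-cmp i j
  ... | tri< i<j _ _ = ⊥-elim (no-early-repetition first i<j j<d same)
  ... | tri≈ _ i≡j _ = i≡j
  ... | tri> _ _ j<i = ⊥-elim (no-early-repetition first j<i i<d (sym same))

least-witness : ∀ {P : ℕ → Set} → (∀ n → Dec (P n)) → ∀ {N} → P N →
  ∃ λ m → P m × (∀ k → k < m → ¬ P k)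
least-witness {P} P? {N} = <-rec (λ N → P N → ∃ λ m → P m × (∀ k → k < m → ¬ P k)) search N
  where
  search : ∀ N → (∀ {k} → k < N → P k → ∃ λ m → P m × (∀ k → k < m → ¬ P k)) →
    P N → ∃ λ m → P m × (∀ k → k < m → ¬ P k)
  search N smaller pN with anyUpTo? P? N
  ... | yes (k , k<N , pk) = smaller k<N pk
  ... | no none            = N , pN , λ k k<N pk → none (k , k<N , pk)

first-return : ∀ {A : Set} → DecidableEquality A → (u : ℕ → A) →
  ∀ {N} → 0 < N → u N ≡ u 0 → ∃ (FirstReturn u)
first-return _≟ᴬ_ u N>0 uN≡u0 = from-least (least-witness returns? (N>0 , uN≡u0))
  where
  Returns : ℕ → Set
  Returns k = 0 < k × u k ≡ u 0
  returns? : ∀ k → Dec (Returns k)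
  returns? k = (0 <? k) ×-dec (u k ≟ᴬ u 0)
  from-least : (∃ λ m → Returns m × (∀ k → k < m → ¬ Returns k)) → ∃ (FirstReturn u)
  from-least (m , (m>0 , um≡u0) , below) = m , record
    { positive = m>0
    ; returns  = um≡u0
    ; minimal  = λ k k>0 k<m uk≡u0 → below k k<m (k>0 , uk≡u0)
    }

fold-commute : ∀ {A : Set} (f h : A → A) → (∀ z → h (f z) ≡ f (h z)) →
  ∀ z i → fold (h z) f i ≡ h (fold z f i)
fold-commute f h commute z zero    = refl
fold-commute f h commute z (suc i) = trans (cong f (fold-commute f h commute z i)) (sym (commute (fold z f i)))

toℕ-next : ∀ {k} (i : Fin (suc k)) → toℕ (next i) ≡ suc (toℕ i) % suc k
toℕ-next i = toℕ-fromℕ< _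

squaring-cycle : ∀ {m} .{{_ : NonZero m}} (u : ℕ → ℕ) → (∀ i → u (suc i) ≡ sq m (u i)) →
  (∀ i → u i < m) → ∀ {d} → FirstReturn u d → Cycle m d
squaring-cycle u step u<m {zero}   first = ⊥-elim (n≮0 (FirstReturn.positive first))
squaring-cycle {m} u step u<m {suc d'} first = record
  { len-1    = d'
  ; len≡     = refl
  ; x        = λ i → u (toℕ i)
  ; x<m      = λ i → u<m (toℕ i)
  ; distinct = λ same → toℕ-injective (first-return-injective first (toℕ<n _) (toℕ<n _) same)
  ; squares  = λ i → begin
      sq m (u (toℕ i))              ≡⟨ sym (step (toℕ i)) ⟩
      u (suc (toℕ i))               ≡⟨ sym (periodic-mod (FirstReturn.returns first) (suc (toℕ i))) ⟩
      u (suc (toℕ i) % suc d')      ≡⟨ cong u (sym (toℕ-next i)) ⟩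
      u (toℕ (next i))              ∎
  }
  where
  open ≡-Reasoning
  open Recurrence (sq m) u step

module CycleOrbit {m} .{{_ : NonZero m}} {len} (C : Cycle m len) where
  open Cycle C public

  period : ℕ
  period = suc len-1

  orbit : ℕ → ℕ
  orbit i = fold (x 0F) (sq m) i

  orbit-cycle : ∀ i (i<period : i < period) → orbit i ≡ x (fromℕ< i<period)
  orbit-cycle zero    _        = refl
  orbit-cycle (suc i) i+1<period = begin
    sq m (orbit i)                  ≡⟨ cong (sq m) (orbit-cycle i i<period) ⟩
    sq m (x (fromℕ< i<period))      ≡⟨ squares _ ⟩
    x (next (fromℕ< i<period))      ≡⟨ cong x (toℕ-injective (trans (toℕ-next _) successor)) ⟩
    x (fromℕ< i+1<period)           ∎
    where
    open ≡-Reasoning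
    i<period : i < period
    i<period = ≤-trans (n≤1+n (suc i)) i+1<period
    successor : suc (toℕ (fromℕ< i<period)) % period ≡ toℕ (fromℕ< i+1<period)
    successor = trans (cong (λ j → suc j % period) (toℕ-fromℕ< i<period))
      (trans (m<n⇒m%n≡m i+1<period) (sym (toℕ-fromℕ< i+1<period)))

  orbit-returns : orbit period ≡ orbit 0
  orbit-returns = begin
    sq m (orbit len-1)              ≡⟨ cong (sq m) (orbit-cycle len-1 last<period) ⟩
    sq m (x (fromℕ< last<period))   ≡⟨ squares _ ⟩
    x (next (fromℕ< last<period))   ≡⟨ cong x (toℕ-injective (trans (toℕ-next _) wraps)) ⟩
    x 0F                            ∎
    where
    open ≡-Reasoning
    last<period : len-1 < period
    last<period = n<1+n len-1
    wraps : suc (toℕ (fromℕ< last<period)) % period ≡ 0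
    wraps = trans (cong (λ j → suc j % period) (toℕ-fromℕ< last<period)) (n%n≡0 period)

  orbit-injective : ∀ {i j} → i < period → j < period → orbit i ≡ orbit j → i ≡ j
  orbit-injective {i} {j} i<period j<period same =
    trans (sym (toℕ-fromℕ< i<period))
      (trans (cong toℕ (distinct (trans (sym (orbit-cycle i i<period)) (trans same (orbit-cycle j j<period)))))
        (toℕ-fromℕ< j<period))

  orbit<m : ∀ i → orbit i < m
  orbit<m zero    = x<m 0F
  orbit<m (suc i) = m%n<n (orbit i * orbit i) m

module PrimeSquareCycle {n} (prime : Prime (2 + n)) {len} (C : Cycle ((2 + n) ^ 2) len) where
  p : ℕ
  p = 2 + n

  open CycleOrbit C

  residue : ℕ → ℕ
  residue i = orbit i % p

  residue-step : ∀ i → residue (suc i) ≡ sq p (residue i)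
  residue-step i = trans (m∣n⇒o%n%m≡o%m p (p ^ 2) (orbit i * orbit i) (m∣m*n (p ^ 1)))
                         (%-distribˡ-* (orbit i) (orbit i) p)

  open Recurrence (sq p) residue residue-step using (periodic)

  returning : ∃ (FirstReturn residue)
  returning = first-return _≟_ residue {period} z<s (cong (_% p) orbit-returns)

  d : ℕ
  d = proj₁ returning

  first : FirstReturn residue d
  first = proj₂ returning

  instance
    d-nonZero : NonZero d
    d-nonZero = >-nonZero (FirstReturn.positive first)

  residue-cycle : Cycle p d
  residue-cycle = squaring-cycle residue residue-step (λ i → m%n<n (orbit i) p) first

  -- z ↦ z^p mod p² sends the start of the orbit to a point in the same class mod p
  -- (Fermat) which is fixed by the d-th iterate of squaring (power lifting).
  fixed-point : ℕ
  fixed-point = x 0F ^ p % p ^ 2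

  fixed-residue : fixed-point % p ≡ residue 0
  fixed-residue = trans (m∣n⇒o%n%m≡o%m p (p ^ 2) (x 0F ^ p) (m∣m*n (p ^ 1))) (fermat prime (x 0F))

  fixed : fold fixed-point (sq (p ^ 2)) d ≡ fixed-point
  fixed = begin
    fold fixed-point (sq (p ^ 2)) d   ≡⟨ fold-commute (sq (p ^ 2)) (λ z → z ^ p % p ^ 2) (pow-sq-commute (p ^ 2) p) (x 0F) d ⟩
    orbit d ^ p % p ^ 2               ≡⟨ power-lifting p (orbit d) ⟩
    (residue d) ^ p % p ^ 2           ≡⟨ cong (λ r → r ^ p % p ^ 2) (FirstReturn.returns first) ⟩
    (residue 0) ^ p % p ^ 2           ≡⟨ sym (power-lifting p (orbit 0)) ⟩
    fixed-point                       ∎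
    where open ≡-Reasoning

  -- If d < period the fixed point is off the orbit: otherwise the orbit would repeat
  -- after d steps, forcing the period to divide d.
  off-orbit : d < period → ∀ e → orbit e ≢ fixed-point
  off-orbit d<period e on-orbit = n≮0 (subst (0 <_) (orbit-injective d<period z<s returns) (FirstReturn.positive first))
    where
    open Recurrence (sq (p ^ 2)) orbit (λ _ → refl) using (repetition⇒return)
    repeat : orbit (d + e) ≡ orbit e
    repeat = begin
      orbit (d + e)                     ≡⟨ fold-+ (x 0F) (sq (p ^ 2)) d ⟩
      fold (orbit e) (sq (p ^ 2)) d     ≡⟨ cong (λ z → fold z (sq (p ^ 2)) d) on-orbit ⟩
      fold fixed-point (sq (p ^ 2)) d   ≡⟨ fixed ⟩
      fixed-point                       ≡⟨ sym on-orbit ⟩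
      orbit e                           ∎
      where open ≡-Reasoning
    returns : orbit d ≡ orbit 0
    returns = repetition⇒return {period} orbit-returns d e repeat

  -- Main counting step: otherwise orbit 0, orbit d, …, orbit ((p-1)d) and the fixed point
  -- would be p + 1 distinct numbers below p² in one residue class mod p.
  period≤ : period ≤ (p ∸ 1) * d
  period≤ with period ≤? (p ∸ 1) * d
  ... | yes short = short
  ... | no long   = ⊥-elim (residue-class-pigeonhole p (residue 0) sample sample<p² sample-residue sample-injective)
    where
    long-period : (p ∸ 1) * d < period
    long-period = ≰⇒> long
    d<period : d < period
    d<period = ≤-<-trans (m≤m+n d (n * d)) long-period
    index<period : ∀ (j : Fin p) → toℕ j * d < period
    index<period j = ≤-<-trans (*-monoˡ-≤ d (toℕ≤pred[n] j)) long-period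
    sample : Fin (suc p) → ℕ
    sample fzero    = fixed-point
    sample (fsuc j) = orbit (toℕ j * d)
    sample<p² : ∀ i → sample i < p ^ 2
    sample<p² fzero    = m%n<n (x 0F ^ p) (p ^ 2)
    sample<p² (fsuc j) = orbit<m (toℕ j * d)
    sample-residue : ∀ i → sample i % p ≡ residue 0
    sample-residue fzero    = fixed-residue
    sample-residue (fsuc j) = periodic (FirstReturn.returns first) 0 (toℕ j)
    sample-injective : Injective _≡_ _≡_ sample
    sample-injective {fzero}  {fzero}  _    = refl
    sample-injective {fzero}  {fsuc j} same = ⊥-elim (off-orbit d<period (toℕ j * d) (sym same))
    sample-injective {fsuc i} {fzero}  same = ⊥-elim (off-orbit d<period (toℕ i * d) same)
    sample-injective {fsuc i} {fsuc j} same =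
      cong fsuc (toℕ-injective (*-cancelʳ-≡ _ _ d (orbit-injective (index<period i) (index<period j) same)))

  cycle-bound : ∀ b → (∀ k → Cycle p k → k ≤ b) → len ≤ (p ∸ 1) * b
  cycle-bound b maximal = subst (_≤ (p ∸ 1) * b) (sym len≡)
    (≤-trans period≤ (*-monoʳ-≤ (p ∸ 1) (maximal d residue-cycle)))

proposition3 : (p : ℕ) → (pr : Prime p) → (a b : ℕ)
    → IsL (p ^ 2) {{m^n≢0 p 2 {{prime⇒nonZero pr}}}} a
    → IsL p {{prime⇒nonZero pr}} b
    → a ≤ (p ∸ 1) * b
proposition3 0 pr a b _ _ = ⊥-elim (<⇒≱ (nonTrivial⇒n>1 0 {{prime⇒nonTrivial pr}}) z≤n)
proposition3 1 pr a b _ _ = ⊥-elim (<⇒≱ (nonTrivial⇒n>1 1 {{prime⇒nonTrivial pr}}) ≤-refl)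
proposition3 (suc (suc n)) pr a b (cycle , _) (_ , maximal) =
  PrimeSquareCycle.cycle-bound pr cycle b maximal
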